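{- Let $n \geq 1$ and let $\varphi$ be a Boolean formula in Precise Conjunctive Normal Form whose variables are among a set of $n$ variables. If some variable $x$ appears in $\varphi$ (counting occurrences of both $x$ and $\sim x$) more than $v(n) = 3^{n-1}+3^{n-1}-2^{n-1}$ times, then $\varphi$ has no satisfying truth assignment.
   Context: A literal is a variable $x$ or its complement $\sim x$. A clause is a (nonempty) disjunction of literals; a formula in conjunctive normal form is a conjunction of clauses. A Boolean formula is in Precise Conjunctive Normal Form (PCNF) if it is a conjunction of pairwise distinct clauses, where each clause is a disjunction of pairwise distinct literals and no clause contains both a variable and its complement. Clauses are identified as sets of literals. -}

module Defs where

open import Data.Nat using (ℕ; _+_; _∸_; _^_)
open import Data.Fin using (Fin)
import Data.Fin as Fin
open import Data.Bool using (Bool; true; false; not)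
open import Data.Product using (_×_; _,_; proj₁; proj₂; ∃)
open import Data.List using (List; []; length; filter; map)
open import Data.Nat.ListAction using (sum)
open import Data.List.Membership.Propositional using (_∈_)
open import Data.List.Relation.Unary.All using (All)
open import Data.List.Relation.Unary.Any using (Any)
open import Data.List.Relation.Unary.Unique.Propositional using (Unique)
open import Data.List.Relation.Unary.AllPairs using (AllPairs)
open import Relation.Binary.PropositionalEquality using (_≡_)
open import Relation.Nullary using (¬_)

-- A literal over variables Fin n: (x , true) is x, (x , false) is ~x.
Literal : ℕ → Set
Literal n = Fin n × Bool

Clause : ℕ → Set
Clause n = List (Literal n)

Formula : ℕ → Set
Formula n = List (Clause n)

complement : ∀ {n} → Literal n → Literal n
complement (x , b) = (x , not b)

SameClause : ∀ {n} → Clause n → Clause n → Set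
SameClause c d = (∀ l → l ∈ c → l ∈ d) × (∀ l → l ∈ d → l ∈ c)

record PreciseClause {n : ℕ} (c : Clause n) : Set where
  field
    nonempty      : ∃ λ l → l ∈ c
    distinct      : Unique c
    noComplements : ∀ l → l ∈ c → ¬ (complement l ∈ c)

record PCNF {n : ℕ} (φ : Formula n) : Set where
  field
    clauses  : All PreciseClause φ
    distinct : AllPairs (λ c d → ¬ SameClause c d) φ

Assignment : ℕ → Set
Assignment n = Fin n → Bool

SatLiteral : ∀ {n} → Assignment n → Literal n → Set
SatLiteral a (x , b) = a x ≡ b

SatClause : ∀ {n} → Assignment n → Clause n → Set
SatClause a c = Any (SatLiteral a) c

Satisfies : ∀ {n} → Assignment n → Formula n → Set
Satisfies a φ = All (SatClause a) φ

Satisfiable : ∀ {n} → Formula n → Set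
Satisfiable {n} φ = ∃ λ (a : Assignment n) → Satisfies a φ

occClause : ∀ {n} → Fin n → Clause n → ℕ
occClause x c = length (filter (λ l → proj₁ l Fin.≟ x) c)

occurrences : ∀ {n} → Fin n → Formula n → ℕ
occurrences x φ = sum (map (occClause x) φ)

v : ℕ → ℕ
v n = 3 ^ (n ∸ 1) + 3 ^ (n ∸ 1) ∸ 2 ^ (n ∸ 1)

-- A complement-free clause contains each variable at most once and is determined by its sign
-- vector in {absent, +, −}ⁿ, so the clauses of a PCNF have pairwise distinct sign vectors.
-- The sign vector of a clause that contains x and is satisfied by a either has a(x) at x
-- (3ⁿ⁻¹ vectors), or has ¬a(x) at x and agrees with a at some other variable
-- (3ⁿ⁻¹ − 2ⁿ⁻¹ vectors).  Hence at most v(n) clauses contain x, each exactly once.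
module Submission where

open import Defs
open import Data.Bool using (Bool; true; false; not)
open import Data.Bool.Properties using (not-¬)
open import Data.Empty using (⊥-elim)
open import Data.Fin using (Fin; zero; suc; punchIn; punchOut)
import Data.Fin as Fin
open import Data.Fin.Properties using (punchIn-punchOut)
open import Data.List using (List; []; _∷_; [_]; _++_; length; map; filter)
open import Data.List.Properties using (length-++; length-map; length-removeAt′)
open import Data.List.Membership.Propositional using (_∈_; find)
open import Data.List.Membership.Propositional.Properties using (∈-map⁺; ∈-map⁻; ∈-++⁺ˡ; ∈-++⁺ʳ; ∈-filter⁻)
open import Data.List.Relation.Binary.Subset.Propositional using (_⊆_)
open import Data.List.Relation.Unary.All as All using (All; []; _∷_)
import Data.List.Relation.Unary.All.Properties as All
open import Data.List.Relation.Unary.AllPairs as AllPairs using (AllPairs; []; _∷_)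
import Data.List.Relation.Unary.AllPairs.Properties as AllPairs
open import Data.List.Relation.Unary.Any using (here; there; index; _─_)
open import Data.List.Relation.Unary.Unique.Propositional using (Unique)
import Data.List.Relation.Unary.Unique.Propositional.Properties as Unique
open import Data.Maybe using (Maybe; just; nothing)
open import Data.Maybe.Properties using (just-injective)
open import Data.Nat using (ℕ; zero; suc; _+_; _*_; _∸_; _^_; _≤_; _>_; _≤?_; z≤n; s≤s)
open import Data.Nat.ListAction using (sum)
open import Data.Nat.Properties using (+-identityʳ; +-assoc; <⇒≱; m+n∸n≡m; module ≤-Reasoning)
open import Data.Nat.Tactic.RingSolver using (solve-∀)
open import Data.Product using (_,_; proj₁; proj₂; ∃)
open import Data.Sum using (_⊎_; inj₁; inj₂)
open import Data.Vec using (Vec; []; _∷_; lookup; tabulate; insertAt; removeAt)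
open import Data.Vec.Properties using (lookup∘tabulate; insertAt-removeAt; removeAt-punchOut)
open import Function using (_∘_)
open import Relation.Binary.PropositionalEquality using (_≡_; _≢_; refl; sym; trans; cong; cong₂; subst; ≢-sym; module ≡-Reasoning)
open import Relation.Nullary using (¬_; Dec; yes; no; contradiction)

private
  variable
    A B : Set

∈-─ : ∀ {x y : A} {ys} (x∈ys : x ∈ ys) → y ∈ ys → y ≢ x → y ∈ (ys ─ x∈ys)
∈-─ (here refl) (here refl) y≢x = contradiction refl y≢x
∈-─ (here _)    (there y∈)  _   = y∈
∈-─ (there _)   (here refl) _   = here refl
∈-─ (there x∈)  (there y∈)  y≢x = there (∈-─ x∈ y∈ y≢x)

unique-⊆⇒length≤ : {xs ys : List A} → Unique xs → xs ⊆ ys → length xs ≤ length ys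
unique-⊆⇒length≤ {xs = []}     _            _   = z≤n
unique-⊆⇒length≤ {xs = x ∷ xs} {ys} (x∉xs ∷ xs!) xs⊆ys = begin
  suc (length xs)          ≤⟨ s≤s (unique-⊆⇒length≤ xs! xs⊆ys─x) ⟩
  suc (length (ys ─ x∈ys)) ≡⟨ length-removeAt′ ys (index x∈ys) ⟨
  length ys                ∎
  where
  open ≤-Reasoning
  x∈ys = xs⊆ys (here refl)
  xs⊆ys─x : xs ⊆ (ys ─ x∈ys)
  xs⊆ys─x y∈xs = ∈-─ x∈ys (xs⊆ys (there y∈xs)) (≢-sym (All.lookup x∉xs y∈xs))

unique-constant⇒length≤1 : {xs : List A} → Unique xs →
  (∀ {u w} → u ∈ xs → w ∈ xs → u ≡ w) → length xs ≤ 1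
unique-constant⇒length≤1 {xs = []}         _                  _ = z≤n
unique-constant⇒length≤1 {xs = _ ∷ []}     _                  _ = s≤s z≤n
unique-constant⇒length≤1 {xs = _ ∷ _ ∷ _} ((u≢w ∷ _) ∷ _) const =
  contradiction (const (here refl) (there (here refl))) u≢w

sum-map≤length-filter : (f : A → ℕ) (xs : List A) → All (λ x → f x ≤ 1) xs →
  sum (map f xs) ≤ length (filter (λ x → 1 ≤? f x) xs)
sum-map≤length-filter f []       []           = z≤n
sum-map≤length-filter f (x ∷ xs) (fx≤1 ∷ fxs≤1) with f x | fx≤1
... | 0           | _      = sum-map≤length-filter f xs fxs≤1
... | 1           | _      = s≤s (sum-map≤length-filter f xs fxs≤1)
... | suc (suc _) | s≤s ()

AllPairs-map-under-All : ∀ {P : A → Set} {R S : A → A → Set} →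
  (∀ {x y} → P x → P y → R x y → S x y) →
  ∀ {xs} → All P xs → AllPairs R xs → AllPairs S xs
AllPairs-map-under-All f []         []         = []
AllPairs-map-under-All f (px ∷ pxs) (rx ∷ rxs) =
  All.zipWith (λ (py , r) → f px py r) (pxs , rx) ∷ AllPairs-map-under-All f pxs rxs

≡-or-≡-not : (b c : Bool) → b ≡ c ⊎ b ≡ not c
≡-or-≡-not false false = inj₁ refl
≡-or-≡-not false true  = inj₂ refl
≡-or-≡-not true  false = inj₂ refl
≡-or-≡-not true  true  = inj₁ refl

-- The sign of a variable in a clause: absent (nothing), positive (just true) or negative.
Sign : Set
Sign = Maybe Bool

SatSigns : ∀ {n} → Assignment n → Vec Sign n → Set
SatSigns a s = ∃ λ y → lookup s y ≡ just (a y)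

signs : (n : ℕ) → List (Vec Sign n)
signs zero    = [ [] ]
signs (suc n) =
  map (nothing ∷_) (signs n) ++ map (just true ∷_) (signs n) ++ map (just false ∷_) (signs n)

satisfying : (n : ℕ) → Assignment n → List (Vec Sign n)
satisfyingMentioning : ∀ {m} → Fin (suc m) → Assignment (suc m) → List (Vec Sign (suc m))

satisfying zero    a = []
satisfying (suc n) a = satisfyingMentioning zero a ++ map (nothing ∷_) (satisfying n (a ∘ suc))

satisfyingMentioning {m} x a =
  map (λ s → insertAt s x (just (a x))) (signs m) ++
  map (λ s → insertAt s x (just (not (a x)))) (satisfying m (a ∘ punchIn x))

length-map-++ : ∀ (f : A → B) xs ys → length (map f xs ++ ys) ≡ length xs + length ys
length-map-++ f xs ys = trans (length-++ (map f xs)) (cong (_+ length ys) (length-map f xs))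

length-signs : ∀ n → length (signs n) ≡ 3 ^ n
length-signs zero    = refl
length-signs (suc n) = begin
  length (map (nothing ∷_) S ++ map (just true ∷_) S ++ map (just false ∷_) S)
    ≡⟨ length-map-++ _ S _ ⟩
  length S + length (map (just true ∷_) S ++ map (just false ∷_) S)
    ≡⟨ cong (length S +_) (length-map-++ _ S _) ⟩
  length S + (length S + length (map (just false ∷_) S))
    ≡⟨ cong (λ k → length S + (length S + k)) (length-map _ S) ⟩
  length S + (length S + length S)
    ≡⟨ cong (λ k → k + (k + k)) (length-signs n) ⟩
  3 ^ n + (3 ^ n + 3 ^ n)
    ≡⟨ cong (λ k → 3 ^ n + (3 ^ n + k)) (+-identityʳ (3 ^ n)) ⟨
  3 ^ suc n ∎
  where
  open ≡-Reasoning
  S = signs n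

length-satisfying : ∀ n a → length (satisfying n a) + 2 ^ n ≡ 3 ^ n
length-satisfyingMentioning : ∀ {m} x a → length (satisfyingMentioning {m} x a) + 2 ^ m ≡ 3 ^ m + 3 ^ m

length-satisfying zero    a = refl
length-satisfying (suc n) a = begin
  length (T ++ map (nothing ∷_) S) + 2 ^ suc n ≡⟨ cong (_+ 2 ^ suc n) (length-++ T) ⟩
  length T + length (map (nothing ∷_) S) + 2 ^ suc n
    ≡⟨ cong (λ k → length T + k + 2 ^ suc n) (length-map _ S) ⟩
  length T + length S + 2 * 2 ^ n              ≡⟨ regroup (length T) (length S) (2 ^ n) ⟩
  (length T + 2 ^ n) + (length S + 2 ^ n)
    ≡⟨ cong₂ _+_ (length-satisfyingMentioning zero a) (length-satisfying n (a ∘ suc)) ⟩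
  (3 ^ n + 3 ^ n) + 3 ^ n                      ≡⟨ thrice (3 ^ n) ⟩
  3 ^ suc n                                    ∎
  where
  open ≡-Reasoning
  T = satisfyingMentioning zero a
  S = satisfying n (a ∘ suc)
  regroup : ∀ t s p → t + s + 2 * p ≡ (t + p) + (s + p)
  regroup = solve-∀
  thrice : ∀ q → (q + q) + q ≡ 3 * q
  thrice = solve-∀

length-satisfyingMentioning {m} x a = begin
  length (map _ (signs m) ++ map _ S) + 2 ^ m  ≡⟨ cong (_+ 2 ^ m) (length-map-++ _ (signs m) _) ⟩
  length (signs m) + length (map _ S) + 2 ^ m
    ≡⟨ cong₂ (λ k l → k + l + 2 ^ m) (length-signs m) (length-map _ S) ⟩
  3 ^ m + length S + 2 ^ m                     ≡⟨ +-assoc (3 ^ m) (length S) (2 ^ m) ⟩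
  3 ^ m + (length S + 2 ^ m)                   ≡⟨ cong (3 ^ m +_) (length-satisfying m (a ∘ punchIn x)) ⟩
  3 ^ m + 3 ^ m                                ∎
  where
  open ≡-Reasoning
  S = satisfying m (a ∘ punchIn x)

signs-complete : ∀ {n} (s : Vec Sign n) → s ∈ signs n
signs-complete []               = here refl
signs-complete (nothing ∷ s)    = ∈-++⁺ˡ (∈-map⁺ (nothing ∷_) (signs-complete s))
signs-complete (just true ∷ s)  =
  ∈-++⁺ʳ (map (nothing ∷_) (signs _)) (∈-++⁺ˡ (∈-map⁺ (just true ∷_) (signs-complete s)))
signs-complete (just false ∷ s) =
  ∈-++⁺ʳ (map (nothing ∷_) (signs _))
    (∈-++⁺ʳ (map (just true ∷_) (signs _)) (∈-map⁺ (just false ∷_) (signs-complete s)))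

SatSigns-removeAt : ∀ {n} {a : Assignment (suc n)} (s : Vec Sign (suc n)) x →
  lookup s x ≢ just (a x) → SatSigns a s → SatSigns (a ∘ punchIn x) (removeAt s x)
SatSigns-removeAt {a = a} s x sx≢ax (y , sy≡ay) with x Fin.≟ y
... | yes refl = contradiction sy≡ay sx≢ax
... | no x≢y   = punchOut x≢y , (begin
  lookup (removeAt s x) (punchOut x≢y) ≡⟨ removeAt-punchOut s x≢y ⟩
  lookup s y                           ≡⟨ sy≡ay ⟩
  just (a y)                           ≡⟨ cong (just ∘ a) (punchIn-punchOut x≢y) ⟨
  just (a (punchIn x (punchOut x≢y)))  ∎)
  where open ≡-Reasoning

insertAt-removeAt′ : ∀ {n} (s : Vec A (suc n)) x {σ} → lookup s x ≡ σ → insertAt (removeAt s x) x σ ≡ s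
insertAt-removeAt′ s x refl = insertAt-removeAt s x

satisfying-complete : ∀ {n a} (s : Vec Sign n) → SatSigns a s → s ∈ satisfying n a
satisfyingMentioning-complete : ∀ {m} {x : Fin (suc m)} {a} (s : Vec Sign (suc m)) {b} →
  lookup s x ≡ just b → SatSigns a s → s ∈ satisfyingMentioning x a

satisfying-complete []            (() , _)
satisfying-complete {suc n} {a} (nothing ∷ s) sat =
  ∈-++⁺ʳ (satisfyingMentioning zero a) (∈-map⁺ (nothing ∷_) (satisfying-complete s tail-sat))
  where
  tail-sat : SatSigns (a ∘ suc) s
  tail-sat = SatSigns-removeAt (nothing ∷ s) zero (λ ()) sat
satisfying-complete {suc n} {a} (just b ∷ s) sat =
  ∈-++⁺ˡ (satisfyingMentioning-complete {x = zero} (just b ∷ s) refl sat)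

satisfyingMentioning-complete {m} {x} {a} s {b} sx≡b sat with ≡-or-≡-not b (a x)
... | inj₁ refl = subst (_∈ satisfyingMentioning x a) (insertAt-removeAt′ s x sx≡b)
  (∈-++⁺ˡ (∈-map⁺ (λ r → insertAt r x (just (a x))) (signs-complete (removeAt s x))))
... | inj₂ refl = subst (_∈ satisfyingMentioning x a) (insertAt-removeAt′ s x sx≡b)
  (∈-++⁺ʳ (map (λ r → insertAt r x (just (a x))) (signs m))
    (∈-map⁺ (λ r → insertAt r x (just (not (a x))))
      (satisfying-complete (removeAt s x) (SatSigns-removeAt s x sx≢ax sat))))
  where
  sx≢ax : lookup s x ≢ just (a x)
  sx≢ax sx≡ax = not-¬ refl (just-injective (trans (sym sx≡ax) sx≡b))

ComplementFree : ∀ {n} → Clause n → Set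
ComplementFree c = ∀ l → l ∈ c → ¬ complement l ∈ c

same-variable⇒≡ : ∀ {n} {c : Clause n} {l l′ : Literal n} → ComplementFree c →
  l ∈ c → l′ ∈ c → proj₁ l ≡ proj₁ l′ → l ≡ l′
same-variable⇒≡ {l = _ , false} {_ , false} _  _  _   refl = refl
same-variable⇒≡ {l = _ , true}  {_ , true}  _  _  _   refl = refl
same-variable⇒≡ {l = l@(_ , false)} {_ , true}  cf l∈ l′∈ refl = ⊥-elim (cf l l∈ l′∈)
same-variable⇒≡ {l = l@(_ , true)}  {_ , false} cf l∈ l′∈ refl = ⊥-elim (cf l l∈ l′∈)

sign : ∀ {n} → Clause n → Fin n → Sign
sign []            y = nothing
sign ((z , b) ∷ c) y with z Fin.≟ y
... | yes _ = just b
... | no _  = sign c y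

sign-sound : ∀ {n} (c : Clause n) {y b} → sign c y ≡ just b → (y , b) ∈ c
sign-sound ((z , b′) ∷ c) {y} s≡b with z Fin.≟ y
... | yes refl = here (cong (y ,_) (sym (just-injective s≡b)))
... | no _     = there (sign-sound c s≡b)

sign-complete : ∀ {n} {c : Clause n} {y b} → ComplementFree c → (y , b) ∈ c → sign c y ≡ just b
sign-complete {c = (z , b′) ∷ c} {y} cf y,b∈ with z Fin.≟ y | y,b∈
... | yes refl | _            = cong (just ∘ proj₂) (same-variable⇒≡ cf (here refl) y,b∈ refl)
... | no z≢y   | here refl    = contradiction refl z≢y
... | no _     | there y,b∈c  = sign-complete (λ l l∈c → cf l (there l∈c) ∘ there) y,b∈c

signature : ∀ {n} → Clause n → Vec Sign n
signature c = tabulate (sign c)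

lookup-signature : ∀ {n} {c : Clause n} {y b} → ComplementFree c → (y , b) ∈ c →
  lookup (signature c) y ≡ just b
lookup-signature {c = c} {y} cf y,b∈c = trans (lookup∘tabulate (sign c) y) (sign-complete cf y,b∈c)

signature-⊆ : ∀ {n} {c d : Clause n} → ComplementFree c → signature c ≡ signature d → c ⊆ d
signature-⊆ {c = c} {d} cf c≡d {y , b} y,b∈c = sign-sound d (begin
  sign d y               ≡⟨ lookup∘tabulate (sign d) y ⟨
  lookup (signature d) y ≡⟨ cong (λ s → lookup s y) c≡d ⟨
  lookup (signature c) y ≡⟨ lookup-signature cf y,b∈c ⟩
  just b                 ∎)
  where open ≡-Reasoning

signature-injective : ∀ {n} {c d : Clause n} → ComplementFree c → ComplementFree d →
  signature c ≡ signature d → SameClause c d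
signature-injective cf cf′ c≡d = (λ _ → signature-⊆ cf c≡d) , (λ _ → signature-⊆ cf′ (sym c≡d))

Mentions : ∀ {n} → Fin n → Clause n → Set
Mentions x c = 1 ≤ occClause x c

mentions? : ∀ {n} (x : Fin n) (c : Clause n) → Dec (Mentions x c)
mentions? x c = 1 ≤? occClause x c

length≥1⇒∃∈ : {xs : List A} → 1 ≤ length xs → ∃ λ x → x ∈ xs
length≥1⇒∃∈ {xs = x ∷ _} _ = x , here refl

hasVariable? : ∀ {n} (x : Fin n) (l : Literal n) → Dec (proj₁ l ≡ x)
hasVariable? x l = proj₁ l Fin.≟ x

occClause≤1 : ∀ {n} (x : Fin n) {c : Clause n} → PreciseClause c → occClause x c ≤ 1
occClause≤1 x {c} pc = unique-constant⇒length≤1 (Unique.filter⁺ (hasVariable? x) distinct) same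
  where
  open PreciseClause pc
  same : ∀ {u w} → u ∈ filter (hasVariable? x) c → w ∈ filter (hasVariable? x) c → u ≡ w
  same u∈ w∈ with ∈-filter⁻ (hasVariable? x) u∈ | ∈-filter⁻ (hasVariable? x) w∈
  ... | u∈c , refl | w∈c , w-on-x = same-variable⇒≡ noComplements u∈c w∈c (sym w-on-x)

signature-mentions : ∀ {n} {x : Fin n} {c : Clause n} → ComplementFree c → Mentions x c →
  ∃ λ b → lookup (signature c) x ≡ just b
signature-mentions {x = x} {c} cf occ with length≥1⇒∃∈ {xs = filter (hasVariable? x) c} occ
... | (y , b) , y,b∈ with ∈-filter⁻ (hasVariable? x) {xs = c} y,b∈
...   | y,b∈c , refl = b , lookup-signature cf y,b∈c

SatSigns-signature : ∀ {n} {a : Assignment n} {c : Clause n} → ComplementFree c → SatClause a c →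
  SatSigns a (signature c)
SatSigns-signature cf sat with find sat
... | (y , b) , y,b∈c , ay≡b = y , trans (lookup-signature cf y,b∈c) (cong just (sym ay≡b))

signatures-unique : ∀ {n} {φ : Formula n} → All ComplementFree φ →
  AllPairs (λ c d → ¬ SameClause c d) φ → Unique (map signature φ)
signatures-unique cfs distinct = AllPairs.map⁺ (AllPairs-map-under-All
  (λ cf cf′ ¬same c≡d → ¬same (signature-injective cf cf′ c≡d)) cfs distinct)

signatures⊆satisfyingMentioning : ∀ {m} {φ : Formula (suc m)} x a → All ComplementFree φ →
  Satisfies a φ → All (Mentions x) φ → map signature φ ⊆ satisfyingMentioning x a
signatures⊆satisfyingMentioning x a cfs sat occs s∈ with ∈-map⁻ signature s∈
... | c , c∈φ , refl =
  let cf = All.lookup cfs c∈φ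
      b , sx≡b = signature-mentions cf (All.lookup occs c∈φ)
  in satisfyingMentioning-complete (signature c) sx≡b (SatSigns-signature cf (All.lookup sat c∈φ))

length-satisfyingMentioning≡v : ∀ {m} (x : Fin (suc m)) a → length (satisfyingMentioning x a) ≡ v (suc m)
length-satisfyingMentioning≡v {m} x a = begin
  length (satisfyingMentioning x a)                 ≡⟨ m+n∸n≡m _ (2 ^ m) ⟨
  length (satisfyingMentioning x a) + 2 ^ m ∸ 2 ^ m ≡⟨ cong (_∸ 2 ^ m) (length-satisfyingMentioning x a) ⟩
  3 ^ m + 3 ^ m ∸ 2 ^ m                             ∎
  where open ≡-Reasoning

corollary1 : (n : ℕ) → 1 ≤ n → (φ : Formula n) → PCNF φ →
    (x : Fin n) → occurrences x φ > v n → ¬ Satisfiable φ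
corollary1 (suc m) _ φ pcnf x v<occ (a , sat) = <⇒≱ v<occ (begin
  occurrences x φ                   ≤⟨ sum-map≤length-filter (occClause x) φ (All.map (occClause≤1 x) clauses) ⟩
  length ψ                          ≡⟨ length-map signature ψ ⟨
  length (map signature ψ)          ≤⟨ unique-⊆⇒length≤ signatures-unique-ψ signatures⊆-ψ ⟩
  length (satisfyingMentioning x a) ≡⟨ length-satisfyingMentioning≡v x a ⟩
  v (suc m)                         ∎)
  where
  open PCNF pcnf
  open ≤-Reasoning
  ψ : Formula (suc m)
  ψ = filter (mentions? x) φ
  complementFree-ψ : All ComplementFree ψ
  complementFree-ψ = All.filter⁺ (mentions? x) (All.map PreciseClause.noComplements clauses)
  signatures-unique-ψ : Unique (map signature ψ)
  signatures-unique-ψ = signatures-unique complementFree-ψ (AllPairs.filter⁺ (mentions? x) distinct)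
  signatures⊆-ψ : map signature ψ ⊆ satisfyingMentioning x a
  signatures⊆-ψ = signatures⊆satisfyingMentioning x a complementFree-ψ
    (All.filter⁺ (mentions? x) sat) (All.all-filter (mentions? x) φ)
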